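{- Let $f$ be a diffusion. If $f$ satisfies the annotated sort-signature $S(\bar S)[\pi]$ and $S(\bar S)[\pi]\le S'(\bar S')[\pi']$, then $f$ satisfies $S'(\bar S')[\pi']$.
   Context: Types are $T::=G\mid\langle T,T\rangle$ with $G$ ground types; ground types have total noetherian orders and pairs are ordered lexicographically. Each type has sorts refining it ($\langle S_1,S_2\rangle$ for pair types), a sort $S$ denoting $[\![S]\!]$; $S\le S'$ iff $[\![S]\!]\subseteq[\![S']\!]$; $\top_S$ is the maximum of $[\![S]\!]$; $S\le^{\triangleright}S'$ iff $[\![S]\!]\subseteq[\![S']\!]$ and $\top_S=\top_{S'}$. A diffusion is a pure function $f$ with signature $T(T_1,\dots,T_n)$, $n\ge1$, $T=T_1$; it has sort-signature $S(S_1,\dots,S_n)$ if $[\![f]\!]$ maps $[\![S_1]\!]\times\dots\times[\![S_n]\!]$ into $[\![S]\!]$; such a sort-signature is progressive if $S\le^{\triangleright}S_1$. Leftmost-as-key preorder: on a ground type $v\preceq v'$ iff $v\le v'$; on pairs $\langle v_1,v_2\rangle\preceq\langle v'_1,v'_2\rangle$ iff $v_1\preceq v'_1$; $v\simeq v'$ iff both directions hold; $v\prec v'$ iff $v\preceq v'$ and not $v'\preceq v$. For $\pi\in\{!,?\}$, a diffusion $f$ having a progressive sort-signature $S(S_1\bar S)$ is $\pi$-prestabilising with respect to it if for all $\bar v\in[\![\bar S]\!]$: if $\pi=!$ then (a) for $v,v'\in[\![S_1]\!]$, $v\prec v'$ and $v''=[\![f]\!](v,\bar v)\not\simeq\top_{S_1}$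 imply $v''\prec[\![f]\!](v',\bar v)$, and (b) $v\prec[\![f]\!](v,\bar v)$ for all $v\in[\![S_1]\!]\setminus\{\top_{S_1}\}$; and in both cases $\pi\in\{!,?\}$: (c) $v\preceq v'$ in $[\![S_1]\!]$ implies $[\![f]\!](v,\bar v)\preceq[\![f]\!](v',\bar v)$, and (d) $v\preceq[\![f]\!](v,\bar v)$ for all $v\in[\![S_1]\!]$. An annotated sort-signature $S(\bar S)[\pi]$ is a progressive sort-signature with an annotation $\pi\in\{!,?\}$; $f$ satisfies it iff $f$ is $\pi$-prestabilising with respect to $S(\bar S)$. Annotations are ordered by $!\le ?$ (and reflexively). Stabilising subsigning: $S(S_1\bar S)\le_{\mathrm{stab}}S'(S'_1\bar S')$ iff $S\le^{\triangleright}S'$, $S'_1\le^{\triangleright}S_1$ and $\bar S'\le\bar S$ componentwise. Annotated subsigning: $S(S_1\bar S)[\pi]\le S'(S'_1\bar S')[\pi']$ iff $S(S_1\bar S)\le_{\mathrm{stab}}S'(S'_1\bar S')$ and $\pi\le\pi'$. -}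

module Defs where

open import Level using (0ℓ)
open import Data.Unit using (⊤; tt)
open import Data.Product using (_×_; _,_; proj₁; proj₂)
open import Data.Sum using (_⊎_)
open import Data.List using (List; []; _∷_)
open import Relation.Nullary using (¬_)
open import Relation.Binary.Core using (Rel)
open import Relation.Binary.Structures using (IsTotalOrder)
open import Relation.Binary.PropositionalEquality using (_≡_; _≢_)
open import Induction.WellFounded using (WellFounded)

record GroundType : Set₁ where
  field
    Carrier      : Set
    _≤_          : Rel Carrier 0ℓ
    isTotalOrder : IsTotalOrder _≡_ _≤_

  _<_ : Rel Carrier 0ℓ
  x < y = (x ≤ y) × (x ≢ y)

  field
    noetherian : WellFounded (λ x y → y < x)

open GroundType

data Ty : Set₁ where
  ground : GroundType → Ty
  ⟨_,_⟩  : Ty → Ty → Ty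

⟦_⟧ : Ty → Set
⟦ ground G ⟧    = Carrier G
⟦ ⟨ T₁ , T₂ ⟩ ⟧ = ⟦ T₁ ⟧ × ⟦ T₂ ⟧

-- The (lexicographic) order on values.  The type T is an explicit
-- argument since ⟦_⟧ is not injective.
LexLeq : (T : Ty) → ⟦ T ⟧ → ⟦ T ⟧ → Set
syntax LexLeq T v v' = v ≤ᵥ[ T ] v'
LexLeq (ground G) v v' = _≤_ G v v'
LexLeq ⟨ T₁ , T₂ ⟩ (v₁ , v₂) (v₁' , v₂') =
  ((v₁ ≤ᵥ[ T₁ ] v₁') × (v₁ ≢ v₁')) ⊎ ((v₁ ≡ v₁') × (v₂ ≤ᵥ[ T₂ ] v₂'))

KeyLeq : (T : Ty) → ⟦ T ⟧ → ⟦ T ⟧ → Set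
syntax KeyLeq T v v' = v ⪯[ T ] v'
KeyLeq (ground G) v v' = _≤_ G v v'
KeyLeq ⟨ T₁ , T₂ ⟩ (v₁ , v₂) (v₁' , v₂') = v₁ ⪯[ T₁ ] v₁'

KeyEq : (T : Ty) → ⟦ T ⟧ → ⟦ T ⟧ → Set
syntax KeyEq T v v' = v ≃[ T ] v'
v ≃[ T ] v' = (v ⪯[ T ] v') × (v' ⪯[ T ] v)

KeyLt : (T : Ty) → ⟦ T ⟧ → ⟦ T ⟧ → Set
syntax KeyLt T v v' = v ≺[ T ] v'
v ≺[ T ] v' = (v ⪯[ T ] v') × ¬ (v' ⪯[ T ] v)

record GroundSort (G : GroundType) : Set₁ where
  field
    member : Carrier G → Set
    top    : Carrier G
    top∈   : member top
    isMax  : ∀ x → member x → _≤_ G x top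

data Sort : Ty → Set₁ where
  gsort  : {G : GroundType} → GroundSort G → Sort (ground G)
  ⟨_,_⟩ₛ : {T₁ T₂ : Ty} → Sort T₁ → Sort T₂ → Sort ⟨ T₁ , T₂ ⟩

_∈ₛ_ : {T : Ty} → ⟦ T ⟧ → Sort T → Set
v ∈ₛ gsort S = GroundSort.member S v
(v₁ , v₂) ∈ₛ ⟨ S₁ , S₂ ⟩ₛ = (v₁ ∈ₛ S₁) × (v₂ ∈ₛ S₂)

topₛ : {T : Ty} → Sort T → ⟦ T ⟧
topₛ (gsort S) = GroundSort.top S
topₛ ⟨ S₁ , S₂ ⟩ₛ = topₛ S₁ , topₛ S₂

_≤ₛ_ : {T : Ty} → Sort T → Sort T → Set
S ≤ₛ S' = ∀ v → v ∈ₛ S → v ∈ₛ S'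

_≤▷_ : {T : Ty} → Sort T → Sort T → Set
S ≤▷ S' = (S ≤ₛ S') × (topₛ S ≡ topₛ S')

Vals : List Ty → Set
Vals []       = ⊤
Vals (T ∷ Ts) = ⟦ T ⟧ × Vals Ts

data Sorts : List Ty → Set₁ where
  []  : Sorts []
  _∷_ : {T : Ty} {Ts : List Ty} → Sort T → Sorts Ts → Sorts (T ∷ Ts)

_∈*_ : {Ts : List Ty} → Vals Ts → Sorts Ts → Set
_∈*_ {[]} _ [] = ⊤
_∈*_ {T ∷ Ts} (v , vs) (S ∷ Ss) = (v ∈ₛ S) × (vs ∈* Ss)

_≤*_ : {Ts : List Ty} → Sorts Ts → Sorts Ts → Set
[] ≤* [] = ⊤
(S ∷ Ss) ≤* (S' ∷ Ss') = (S ≤ₛ S') × (Ss ≤* Ss')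

-- Diffusions: pure functions with signature T(T₁,…,Tₙ), n ≥ 1, T = T₁.
-- The first argument has type T, the remaining n-1 ones have types Ts.

Diffusion : Ty → List Ty → Set
Diffusion T Ts = ⟦ T ⟧ → Vals Ts → ⟦ T ⟧

record SortSig (T : Ty) (Ts : List Ty) : Set₁ where
  constructor sig
  field
    res  : Sort T
    arg₁ : Sort T
    rest : Sorts Ts

open SortSig

HasSortSig : {T : Ty} {Ts : List Ty} → Diffusion T Ts → SortSig T Ts → Set
HasSortSig f σ =
  ∀ v vs → v ∈ₛ arg₁ σ → vs ∈* rest σ → f v vs ∈ₛ res σ

Progressive : {T : Ty} {Ts : List Ty} → SortSig T Ts → Set
Progressive σ = res σ ≤▷ arg₁ σ

data Ann : Set where
  bang qmark : Ann

data _≤ₐ_ : Ann → Ann → Set where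
  refl≤ₐ     : ∀ {π} → π ≤ₐ π
  bang≤qmark : bang ≤ₐ qmark

BangConds : {T : Ty} {Ts : List Ty} → Diffusion T Ts → SortSig T Ts → Set
BangConds {T} f σ = ∀ vs → vs ∈* rest σ →
  (∀ v v' → v ∈ₛ arg₁ σ → v' ∈ₛ arg₁ σ → v ≺[ T ] v' →
     ¬ (f v vs ≃[ T ] topₛ (arg₁ σ)) → f v vs ≺[ T ] f v' vs)
  × (∀ v → v ∈ₛ arg₁ σ → v ≢ topₛ (arg₁ σ) → v ≺[ T ] f v vs)

CommonConds : {T : Ty} {Ts : List Ty} → Diffusion T Ts → SortSig T Ts → Set
CommonConds {T} f σ = ∀ vs → vs ∈* rest σ →
  (∀ v v' → v ∈ₛ arg₁ σ → v' ∈ₛ arg₁ σ → v ⪯[ T ] v' → f v vs ⪯[ T ] f v' vs)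
  × (∀ v → v ∈ₛ arg₁ σ → v ⪯[ T ] f v vs)

Prestabilising : {T : Ty} {Ts : List Ty} →
                 Ann → Diffusion T Ts → SortSig T Ts → Set
Prestabilising bang  f σ = HasSortSig f σ × BangConds f σ × CommonConds f σ
Prestabilising qmark f σ = HasSortSig f σ × CommonConds f σ

record AnnSig (T : Ty) (Ts : List Ty) : Set₁ where
  constructor annsig
  field
    σ           : SortSig T Ts
    progressive : Progressive σ
    π           : Ann

Satisfies : {T : Ty} {Ts : List Ty} → Diffusion T Ts → AnnSig T Ts → Set
Satisfies f A = Prestabilising (AnnSig.π A) f (AnnSig.σ A)

_≤stab_ : {T : Ty} {Ts : List Ty} → SortSig T Ts → SortSig T Ts → Set
σ ≤stab σ' = (res σ ≤▷ res σ') × (arg₁ σ' ≤▷ arg₁ σ) × (rest σ' ≤* rest σ)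

_≤ann_ : {T : Ty} {Ts : List Ty} → AnnSig T Ts → AnnSig T Ts → Set
A ≤ann A' = (AnnSig.σ A ≤stab AnnSig.σ A') × (AnnSig.π A ≤ₐ AnnSig.π A')

-- Every prestabilisation condition is universally quantified over the first and remaining
-- arguments and concludes about results, so it survives shrinking the argument sorts and
-- enlarging the result sort; the conditions for ? are a subset of those for !.

module Submission where

open import Defs
open import Data.List using (List; []; _∷_)
open import Data.Product using (_,_; proj₁)
open import Data.Unit using (tt)
open import Relation.Binary.PropositionalEquality using (_≡_; subst; sym)

open SortSig

∈*-mono : {Ts : List Ty} {Ss Ss' : Sorts Ts} → Ss ≤* Ss' →
          ∀ vs → vs ∈* Ss → vs ∈* Ss'
∈*-mono {Ss = []}     {[]}       _          _        _        = tt
∈*-mono {Ss = _ ∷ _}  {_ ∷ _}    (S≤ , Ss≤) (v , vs) (v∈ , vs∈) =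
  S≤ v v∈ , ∈*-mono Ss≤ vs vs∈

module _ {T : Ty} {Ts : List Ty} {f : Diffusion T Ts} {σ σ' : SortSig T Ts} where

  hasSortSig-mono : res σ ≤ₛ res σ' → arg₁ σ' ≤ₛ arg₁ σ → rest σ' ≤* rest σ →
                    HasSortSig f σ → HasSortSig f σ'
  hasSortSig-mono res≤ arg≤ rest≤ hasSig v vs v∈ vs∈ =
    res≤ (f v vs) (hasSig v vs (arg≤ v v∈) (∈*-mono rest≤ vs vs∈))

  commonConds-mono : arg₁ σ' ≤ₛ arg₁ σ → rest σ' ≤* rest σ →
                     CommonConds f σ → CommonConds f σ'
  commonConds-mono arg≤ rest≤ common vs vs∈
    with monotone , inflationary ← common vs (∈*-mono rest≤ vs vs∈) =
      (λ v v' v∈ v'∈ → monotone v v' (arg≤ v v∈) (arg≤ v' v'∈))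
    , (λ v v∈ → inflationary v (arg≤ v v∈))

  -- (a) and (b) refer to ⊤ of the first argument sort, so shrinking it must keep its top.
  bangConds-mono : arg₁ σ' ≤▷ arg₁ σ → rest σ' ≤* rest σ →
                   BangConds f σ → BangConds f σ'
  bangConds-mono (arg≤ , top≡) rest≤ conds vs vs∈
    with strictlyMonotone , strictlyInflationary ← conds vs (∈*-mono rest≤ vs vs∈) =
      (λ v v' v∈ v'∈ v≺v' notTop → strictlyMonotone v v' (arg≤ v v∈) (arg≤ v' v'∈) v≺v'
          (λ atTop → notTop (subst (KeyEq T (f v vs)) (sym top≡) atTop)))
    , (λ v v∈ notTop → strictlyInflationary v (arg≤ v v∈)
          (λ atTop → notTop (subst (v ≡_) (sym top≡) atTop)))

  prestabilising-mono : ∀ π → σ ≤stab σ' → Prestabilising π f σ → Prestabilising π f σ'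
  prestabilising-mono bang (res≤ , arg≤ , rest≤) (hasSig , bangConds , common) =
      hasSortSig-mono (proj₁ res≤) (proj₁ arg≤) rest≤ hasSig
    , bangConds-mono arg≤ rest≤ bangConds
    , commonConds-mono (proj₁ arg≤) rest≤ common
  prestabilising-mono qmark (res≤ , arg≤ , rest≤) (hasSig , common) =
      hasSortSig-mono (proj₁ res≤) (proj₁ arg≤) rest≤ hasSig
    , commonConds-mono (proj₁ arg≤) rest≤ common

prestabilising-weaken : {T : Ty} {Ts : List Ty} {f : Diffusion T Ts} {σ : SortSig T Ts}
                        {π π' : Ann} → π ≤ₐ π' → Prestabilising π f σ → Prestabilising π' f σ
prestabilising-weaken refl≤ₐ     prestab               = prestab
prestabilising-weaken bang≤qmark (hasSig , _ , common) = hasSig , common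

proposition7p4 : {T : Ty} {Ts : List Ty} (f : Diffusion T Ts) (A A' : AnnSig T Ts) →
    Satisfies f A → A ≤ann A' → Satisfies f A'
proposition7p4 f (annsig σ _ π) (annsig σ' _ π') satisfies (σ≤σ' , π≤π') =
  prestabilising-weaken π≤π' (prestabilising-mono π σ≤σ' satisfies)
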